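{- Let $\theta>0$ and $n\ge1$. Under the Ewens-like distribution for records with parameter $\theta$ on $\mathfrak{S}_n$, the expected value of the first entry of the permutation is $$\mathbb{E}_n[\sigma(1)]=\frac{\theta+n}{\theta+1}.$$
   Context: $\mathfrak{S}_n$ is the set of permutations of $[n]=\{1,\dots,n\}$. A permutation $\sigma$ has a record at position $i$ if $\sigma(i)>\sigma(j)$ for all $j<i$; $\mathrm{rec}(\sigma)$ is the number of records. The Ewens-like distribution for records with parameter $\theta>0$ gives each $\sigma\in\mathfrak{S}_n$ probability proportional to $\theta^{\mathrm{rec}(\sigma)}$; $\mathbb{E}_n$ denotes expectation under it.
   Formalization: The parameter θ ranges over the positive rationals instead of the positive reals. -}

module Defs where

open import Data.Nat as ℕ using (ℕ; zero; suc)
open import Data.Fin as Fin using (Fin; toℕ)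
open import Data.Vec as Vec using (Vec; []; _∷_)
open import Data.List as List using (List; []; _∷_; filter; map; concatMap)
open import Data.List.Relation.Unary.All using (all?)
open import Data.List.Relation.Unary.Unique.DecPropositional ℕ._≟_ using (unique?)
open import Data.Rational as ℚ using (ℚ; 0ℚ; 1ℚ; _+_; _*_; _÷_; ≢-nonZero)
open import Data.Rational.Properties using (_≟_)
open import Relation.Nullary using (yes; no)
open import Data.Integer using (+_)
open import Relation.Nullary.Decidable using (⌊_⌋)

allWords : (n k : ℕ) → List (Vec (Fin n) k)
allWords n zero    = [] ∷ []
allWords n (suc k) = concatMap (λ x → map (x ∷_) (allWords n k)) (List.allFin n)

-- 𝔖_n: a permutation σ of [n] is represented by its one-line notation
-- (σ(1), …, σ(n)), entry σ(i) stored as the element of Fin n with toℕ = σ(i) - 1.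
-- 𝔖_n = the words of length n over [n] with pairwise distinct entries.
perms : (n : ℕ) → List (Vec (Fin n) n)
perms n = filter (λ w → unique? (List.map toℕ (Vec.toList w))) (allWords n n)

-- Number of records of a word: positions i with w(i) > w(j) for all j < i.
-- recAux pre xs: pre is the (reversed) prefix already scanned.
recAux : List ℕ → List ℕ → ℕ
recAux pre []       = 0
recAux pre (x ∷ xs) with all? (λ y → y ℕ.<? x) pre
... | yes _ = suc (recAux (x ∷ pre) xs)
... | no  _ = recAux (x ∷ pre) xs

rec : ∀ {n} → Vec (Fin n) n → ℕ
rec σ = recAux [] (List.map toℕ (Vec.toList σ))

ℕtoℚ : ℕ → ℚ
ℕtoℚ k = (+ k) ℚ./ 1

_^_ : ℚ → ℕ → ℚ
x ^ zero  = 1ℚ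
x ^ suc k = x * (x ^ k)

sumℚ : List ℚ → ℚ
sumℚ = List.foldr _+_ 0ℚ

-- Division, with the (never used here) convention p / 0 = 0.
_div_ : ℚ → ℚ → ℚ
p div q with q ≟ 0ℚ
... | yes _  = 0ℚ
... | no q≢0 = _÷_ p q {{≢-nonZero q≢0}}

𝔼 : (n : ℕ) (θ : ℚ) → (Vec (Fin n) n → ℚ) → ℚ
𝔼 n θ f = sumℚ (map (λ σ → (θ ^ rec σ) * f σ) (perms n))
          div sumℚ (map (λ σ → θ ^ rec σ) (perms n))

firstEntry : ∀ {m} → Vec (Fin (suc m)) (suc m) → ℚ
firstEntry σ = ℕtoℚ (suc (toℕ (Vec.head σ)))

module Submission where

open import Defs
open import Algebra.Bundles using (CommutativeMonoid)
open import Data.Bool using (Bool; true; false; if_then_else_)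
open import Data.Empty using (⊥-elim)
open import Data.Fin using (Fin; toℕ)
import Data.Integer as ℤ
import Data.Integer.Properties as ℤ
open import Data.List as List using (List; []; _∷_; map; concatMap; filter; length; allFin)
import Data.List.Properties as List
open import Data.List.Membership.Propositional using (_∈_; _∉_)
open import Data.List.Relation.Unary.All as All using (All; []; _∷_; all?)
open import Data.List.Relation.Unary.All.Properties using (All¬⇒¬Any; ¬Any⇒All¬)
open import Data.List.Relation.Unary.AllPairs using ([]; _∷_)
open import Data.List.Relation.Unary.Any using (here; there)
open import Data.Nat as ℕ using (ℕ; zero; suc; _<_; z≤n; s≤s; _<?_)
import Data.Nat.Coprimality as Coprime
import Data.Nat.Properties as ℕ
open import Data.List.Membership.DecPropositional ℕ._≟_ using (_∈?_; _∉?_)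
open import Data.List.Relation.Unary.Unique.DecPropositional ℕ._≟_ using (Unique; unique?)
open import Data.Product using (_×_; _,_)
open import Data.Rational as ℚ using (ℚ; 0ℚ; 1ℚ; _+_; _*_; _>_; 1/_; Positive; NonNegative)
import Data.Rational.Properties as ℚ
open import Data.Rational.Solver using (module +-*-Solver)
open import Data.Vec as Vec using (Vec)
open import Function using (_∘_; id; _⇔_)
open import Function.Bundles using (mk⇔)
open import Relation.Binary.PropositionalEquality
  using (_≡_; _≢_; refl; sym; trans; cong; cong₂; module ≡-Reasoning)
open import Relation.Nullary using (Dec; does; yes; no; ¬_; _×-dec_; contradiction)
open import Relation.Nullary.Decidable using (dec-true; dec-false; does-⇔)
open import Relation.Unary using (Decidable)
open import Algebra.Properties.CommutativeSemigroup
  (CommutativeMonoid.commutativeSemigroup ℚ.+-0-commutativeMonoid) using (interchange)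
import Algebra.Properties.CommutativeSemigroup
  (CommutativeMonoid.commutativeSemigroup ℚ.*-1-commutativeMonoid) as *

-- Every word over [n] gets the weight θ^(number of records) if its letters are distinct and 0
-- otherwise, so sums over 𝔖_n become sums over all words, which split by the first letter.
-- The total weight Z of the completions of a prefix depends only on the number c of unused
-- letters below the maximum of the prefix and the number r of letters above it: the next
-- letter is either one of the c unused letters below the maximum (not a record, leaving
-- (c - 1, r)) or the (j+1)-th letter above it (a record, leaving (c + j, r - 1 - j)). This
-- recurrence is solved by C c r = (r+1)⋯(r+c) · θ(θ+1)⋯(θ+r-1). Hence the total weight of 𝔖_n
-- is θ(θ+1)⋯(θ+n-1) = θ W and the sum of θ^rec(σ) σ(1) is θ V, where W and V are antidiagonal
-- sums of C weighted by 1 and by the first letter; recurrences in n give (θ+1) V = (θ+n) W.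

ℕtoℚ-+ : ∀ a b → ℕtoℚ (a ℕ.+ b) ≡ ℕtoℚ a + ℕtoℚ b
ℕtoℚ-+ a b
  rewrite ℚ.normalize-coprime (Coprime.sym (Coprime.1-coprimeTo a))
        | ℚ.normalize-coprime (Coprime.sym (Coprime.1-coprimeTo b))
  = cong (ℚ._/ 1) (sym (cong₂ ℤ._+_ (ℤ.*-identityʳ (ℤ.+ a)) (ℤ.*-identityʳ (ℤ.+ b))))

ℕtoℚ-nonNeg : ∀ k → NonNegative (ℕtoℚ k)
ℕtoℚ-nonNeg k = ℚ.normalize-nonNeg k 1

pos⇒≢0 : ∀ p → .{{Positive p}} → p ≢ 0ℚ
pos⇒≢0 p p≡0 = ℚ.<-irrefl (sym p≡0) (ℚ.positive⁻¹ p)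

*-ifˡ : ∀ k b {x} → k * (if b then x else 0ℚ) ≡ (if b then k * x else 0ℚ)
*-ifˡ k true  = refl
*-ifˡ k false = ℚ.*-zeroʳ k

*-ifʳ : ∀ k b {x} → (if b then x else 0ℚ) * k ≡ (if b then x * k else 0ℚ)
*-ifʳ k true  = refl
*-ifʳ k false = ℚ.*-zeroˡ k

div-cross : ∀ a b p q → b ≢ 0ℚ → q ≢ 0ℚ → a * q ≡ p * b → a div b ≡ p div q
div-cross a b p q b≢0 q≢0 aq≡pb with b ℚ.≟ 0ℚ | q ℚ.≟ 0ℚ
... | yes b≡0 | _       = ⊥-elim (b≢0 b≡0)
... | no _    | yes q≡0 = ⊥-elim (q≢0 q≡0)
... | no b≢0′ | no q≢0′ = cross (1/ b) (1/ q) (ℚ.*-inverseʳ b) (ℚ.*-inverseʳ q)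
  where
  instance
    _ = ℚ.≢-nonZero b≢0′
    _ = ℚ.≢-nonZero q≢0′
  cross : ∀ b⁻¹ q⁻¹ → b * b⁻¹ ≡ 1ℚ → q * q⁻¹ ≡ 1ℚ → a * b⁻¹ ≡ p * q⁻¹
  cross b⁻¹ q⁻¹ bb⁻¹≡1 qq⁻¹≡1 = begin
    a * b⁻¹                  ≡⟨ ℚ.*-identityʳ (a * b⁻¹) ⟨
    (a * b⁻¹) * 1ℚ           ≡⟨ cong ((a * b⁻¹) *_) qq⁻¹≡1 ⟨
    (a * b⁻¹) * (q * q⁻¹)    ≡⟨ *.interchange a b⁻¹ q q⁻¹ ⟩
    (a * q) * (b⁻¹ * q⁻¹)    ≡⟨ cong₂ _*_ aq≡pb (ℚ.*-comm b⁻¹ q⁻¹) ⟩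
    (p * b) * (q⁻¹ * b⁻¹)    ≡⟨ *.interchange p b q⁻¹ b⁻¹ ⟩
    (p * q⁻¹) * (b * b⁻¹)    ≡⟨ cong ((p * q⁻¹) *_) bb⁻¹≡1 ⟩
    (p * q⁻¹) * 1ℚ           ≡⟨ ℚ.*-identityʳ (p * q⁻¹) ⟩
    p * q⁻¹                  ∎
    where open ≡-Reasoning

_↑_ : ℚ → ℕ → ℚ
x ↑ zero  = 1ℚ
x ↑ suc r = x ↑ r * (x + ℕtoℚ r)

↑-pos : ∀ x r → .{{Positive x}} → Positive (x ↑ r)
↑-pos x zero    = _
↑-pos x (suc r) =
  ℚ.pos*pos⇒pos (x ↑ r) {{↑-pos x r}} (x + ℕtoℚ r) {{ℚ.pos+nonNeg⇒pos x (ℕtoℚ r) {{ℕtoℚ-nonNeg r}}}}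

sumℚ-*ˡ : ∀ {A : Set} k (f : A → ℚ) xs → sumℚ (map (λ x → k * f x) xs) ≡ k * sumℚ (map f xs)
sumℚ-*ˡ k f []       = sym (ℚ.*-zeroʳ k)
sumℚ-*ˡ k f (x ∷ xs) =
  trans (cong (k * f x +_) (sumℚ-*ˡ k f xs)) (sym (ℚ.*-distribˡ-+ k (f x) _))

sumℚ-++ : ∀ xs ys → sumℚ (xs List.++ ys) ≡ sumℚ xs + sumℚ ys
sumℚ-++ []       ys = sym (ℚ.+-identityˡ (sumℚ ys))
sumℚ-++ (x ∷ xs) ys = trans (cong (x +_) (sumℚ-++ xs ys)) (sym (ℚ.+-assoc x _ _))

sumℚ-concatMap : ∀ {A B : Set} (g : A → List B) (h : B → ℚ) xs →
  sumℚ (map h (concatMap g xs)) ≡ sumℚ (map (λ x → sumℚ (map h (g x))) xs)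
sumℚ-concatMap g h []       = refl
sumℚ-concatMap g h (x ∷ xs) = begin
  sumℚ (map h (g x List.++ concatMap g xs))
    ≡⟨ cong sumℚ (List.map-++ h (g x) _) ⟩
  sumℚ (map h (g x) List.++ map h (concatMap g xs))
    ≡⟨ sumℚ-++ (map h (g x)) _ ⟩
  sumℚ (map h (g x)) + sumℚ (map h (concatMap g xs))
    ≡⟨ cong (sumℚ (map h (g x)) +_) (sumℚ-concatMap g h xs) ⟩
  sumℚ (map (λ x → sumℚ (map h (g x))) (x ∷ xs)) ∎
  where open ≡-Reasoning

sumℚ-filter : ∀ {A : Set} {P : A → Set} (P? : Decidable P) (f : A → ℚ) xs →
  sumℚ (map f (filter P? xs)) ≡ sumℚ (map (λ x → if does (P? x) then f x else 0ℚ) xs)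
sumℚ-filter P? f []       = refl
sumℚ-filter P? f (x ∷ xs) with does (P? x)
... | true  = cong (f x +_) (sumℚ-filter P? f xs)
... | false = trans (sumℚ-filter P? f xs) (sym (ℚ.+-identityˡ _))

sumℚ-allWords-suc : ∀ n k (h : Vec (Fin n) (suc k) → ℚ) →
  sumℚ (map h (allWords n (suc k))) ≡
  sumℚ (map (λ x → sumℚ (map (λ w → h (x Vec.∷ w)) (allWords n k))) (allFin n))
sumℚ-allWords-suc n k h = trans (sumℚ-concatMap (λ x → map (x Vec.∷_) (allWords n k)) h (allFin n))
  (cong sumℚ (List.map-cong (λ x → cong sumℚ (sym (List.map-∘ (allWords n k)))) (allFin n)))

Σ< : ℕ → (ℕ → ℚ) → ℚ
Σ< zero    f = 0ℚ
Σ< (suc N) f = f 0 + Σ< N (λ i → f (suc i))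

Σ<-cong : ∀ N {f g : ℕ → ℚ} → (∀ {i} → i < N → f i ≡ g i) → Σ< N f ≡ Σ< N g
Σ<-cong zero    f≡g = refl
Σ<-cong (suc N) f≡g = cong₂ _+_ (f≡g (s≤s z≤n)) (Σ<-cong N (λ i<N → f≡g (s≤s i<N)))

Σ<-+ : ∀ a b f → Σ< (a ℕ.+ b) f ≡ Σ< a f + Σ< b (λ j → f (a ℕ.+ j))
Σ<-+ zero    b f = sym (ℚ.+-identityˡ _)
Σ<-+ (suc a) b f =
  trans (cong (f 0 +_) (Σ<-+ a b (λ i → f (suc i)))) (sym (ℚ.+-assoc (f 0) _ _))

Σ<-*ˡ : ∀ N k f → Σ< N (λ i → k * f i) ≡ k * Σ< N f
Σ<-*ˡ zero    k f = sym (ℚ.*-zeroʳ k)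
Σ<-*ˡ (suc N) k f =
  trans (cong (k * f 0 +_) (Σ<-*ˡ N k (λ i → f (suc i)))) (sym (ℚ.*-distribˡ-+ k (f 0) _))

sumℚ-tabulate : ∀ n (g : ℕ → ℚ) → sumℚ (List.tabulate {n = n} (g ∘ toℕ)) ≡ Σ< n g
sumℚ-tabulate zero    g = refl
sumℚ-tabulate (suc n) g = cong (g 0 +_) (sumℚ-tabulate n (λ i → g (suc i)))

sumℚ-allFin : ∀ n (g : ℕ → ℚ) → sumℚ (map (g ∘ toℕ) (allFin n)) ≡ Σ< n g
sumℚ-allFin n g = trans (cong sumℚ (List.map-tabulate {n = n} id (g ∘ toℕ))) (sumℚ-tabulate n g)

count : ℕ → (ℕ → Bool) → ℕ
count zero    b = 0
count (suc N) b = (if b 0 then 1 else 0) ℕ.+ count N (λ i → b (suc i))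

count-cong : ∀ N {b b′ : ℕ → Bool} → (∀ {i} → i < N → b i ≡ b′ i) → count N b ≡ count N b′
count-cong zero    b≡b′ = refl
count-cong (suc N) b≡b′ = cong₂ (λ b0 c → (if b0 then 1 else 0) ℕ.+ c)
  (b≡b′ (s≤s z≤n)) (count-cong N (λ i<N → b≡b′ (s≤s i<N)))

count-true : ∀ N → count N (λ _ → true) ≡ N
count-true zero    = refl
count-true (suc N) = cong suc (count-true N)

count-switch-on : ∀ N x {b b′ : ℕ → Bool} → x < N → b x ≡ false → b′ x ≡ true →
  (∀ {y} → y ≢ x → b y ≡ b′ y) → suc (count N b) ≡ count N b′
count-switch-on (suc N) zero _ bx b′x b≡b′ rewrite bx | b′x =
  cong suc (count-cong N (λ {i} _ → b≡b′ {suc i} λ ()))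
count-switch-on (suc N) (suc x) {b} {b′} (s≤s x<N) bx b′x b≡b′ = begin
  suc ((if b 0 then 1 else 0) ℕ.+ count N (λ i → b (suc i)))
    ≡⟨ ℕ.+-suc _ _ ⟨
  (if b 0 then 1 else 0) ℕ.+ suc (count N (λ i → b (suc i)))
    ≡⟨ cong₂ (λ b0 c → (if b0 then 1 else 0) ℕ.+ c) (b≡b′ (λ ()))
             (count-switch-on N x x<N bx b′x (λ y≢x → b≡b′ (y≢x ∘ cong ℕ.pred))) ⟩
  (if b′ 0 then 1 else 0) ℕ.+ count N (λ i → b′ (suc i)) ∎
  where open ≡-Reasoning

Σ<-indicator : ∀ N b K → Σ< N (λ i → if b i then K else 0ℚ) ≡ ℕtoℚ (count N b) * K
Σ<-indicator zero    b K = sym (ℚ.*-zeroˡ K)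
Σ<-indicator (suc N) b K with b 0
... | true  = begin
  K + Σ< N (λ i → if b (suc i) then K else 0ℚ)
    ≡⟨ cong₂ _+_ (sym (ℚ.*-identityˡ K)) (Σ<-indicator N (λ i → b (suc i)) K) ⟩
  1ℚ * K + ℕtoℚ c * K     ≡⟨ ℚ.*-distribʳ-+ K 1ℚ (ℕtoℚ c) ⟨
  (1ℚ + ℕtoℚ c) * K       ≡⟨ cong (_* K) (ℕtoℚ-+ 1 c) ⟨
  ℕtoℚ (suc c) * K        ∎
  where
  open ≡-Reasoning
  c = count N (λ i → b (suc i))
... | false = trans (ℚ.+-identityˡ _) (Σ<-indicator N (λ i → b (suc i)) K)

-- diag g c r = Σ_{j<r} g (c + j) (r - 1 - j)
diag : (ℕ → ℕ → ℚ) → ℕ → ℕ → ℚ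
diag g c zero    = 0ℚ
diag g c (suc s) = g c s + diag g (suc c) s

Σ<-diag : ∀ r c {f : ℕ → ℚ} {g : ℕ → ℕ → ℚ} →
  (∀ {j s} → j ℕ.+ suc s ≡ r → f j ≡ g (c ℕ.+ j) s) → Σ< r f ≡ diag g c r
Σ<-diag zero    c f≡g = refl
Σ<-diag (suc s) c {f} {g} f≡g = cong₂ _+_
  (trans (f≡g refl) (cong (λ i → g i s) (ℕ.+-identityʳ c)))
  (Σ<-diag s (suc c) λ {j} {s′} e → trans (f≡g (cong suc e)) (cong (λ i → g i s′) (ℕ.+-suc c j)))

diag-cong : ∀ r c {g h : ℕ → ℕ → ℚ} → (∀ i s → g i s ≡ h i s) → diag g c r ≡ diag h c r
diag-cong zero    c g≡h = refl
diag-cong (suc s) c g≡h = cong₂ _+_ (g≡h c s) (diag-cong s (suc c) g≡h)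

diag-+ : ∀ r c (g h : ℕ → ℕ → ℚ) → diag (λ i s → g i s + h i s) c r ≡ diag g c r + diag h c r
diag-+ zero    c g h = refl
diag-+ (suc s) c g h = begin
  (g c s + h c s) + diag (λ i s → g i s + h i s) (suc c) s
    ≡⟨ cong ((g c s + h c s) +_) (diag-+ s (suc c) g h) ⟩
  (g c s + h c s) + (diag g (suc c) s + diag h (suc c) s)
    ≡⟨ interchange (g c s) (h c s) _ _ ⟩
  (g c s + diag g (suc c) s) + (h c s + diag h (suc c) s) ∎
  where open ≡-Reasoning

diag-shift : ∀ r c {g h : ℕ → ℕ → ℚ} → (∀ i s → g (suc i) s ≡ ℕtoℚ (suc (i ℕ.+ s)) * h i s) →
  diag g (suc c) r ≡ ℕtoℚ (c ℕ.+ r) * diag h c r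
diag-shift zero    c g≡h = sym (ℚ.*-zeroʳ (ℕtoℚ (c ℕ.+ 0)))
diag-shift (suc s) c {g} {h} g≡h = begin
  g (suc c) s + diag g (suc (suc c)) s
    ≡⟨ cong₂ _+_ (g≡h c s) (diag-shift s (suc c) g≡h) ⟩
  ℕtoℚ (suc (c ℕ.+ s)) * h c s + ℕtoℚ (suc (c ℕ.+ s)) * diag h (suc c) s
    ≡⟨ ℚ.*-distribˡ-+ (ℕtoℚ (suc (c ℕ.+ s))) (h c s) _ ⟨
  ℕtoℚ (suc (c ℕ.+ s)) * (h c s + diag h (suc c) s)
    ≡⟨ cong (λ k → ℕtoℚ k * (h c s + diag h (suc c) s)) (ℕ.+-suc c s) ⟨
  ℕtoℚ (c ℕ.+ suc s) * (h c s + diag h (suc c) s) ∎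
  where open ≡-Reasoning

count-∉ : ∀ N pre → Unique pre → All (_< N) pre → count N (λ y → does (y ∉? pre)) ℕ.+ length pre ≡ N
count-∉ N []       _             _             = trans (ℕ.+-identityʳ _) (count-true N)
count-∉ N (x ∷ xs) (x≢xs ∷ uniq) (x<N ∷ xs<N) = begin
  count N (λ y → does (y ∉? x ∷ xs)) ℕ.+ suc (length xs)
    ≡⟨ ℕ.+-suc _ _ ⟩
  suc (count N (λ y → does (y ∉? x ∷ xs))) ℕ.+ length xs
    ≡⟨ cong (ℕ._+ length xs) (count-switch-on N x x<N x∈ x∉xs others) ⟩
  count N (λ y → does (y ∉? xs)) ℕ.+ length xs
    ≡⟨ count-∉ N xs uniq xs<N ⟩
  N ∎
  where
  open ≡-Reasoning
  x∈ : does (x ∉? x ∷ xs) ≡ false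
  x∈ = dec-false (x ∉? x ∷ xs) (λ x∉ → x∉ (here refl))
  x∉xs : does (x ∉? xs) ≡ true
  x∉xs = dec-true (x ∉? xs) (All¬⇒¬Any x≢xs)
  others : ∀ {y} → y ≢ x → does (y ∉? x ∷ xs) ≡ does (y ∉? xs)
  others {y} y≢x = does-⇔ (mk⇔ (λ y∉ y∈xs → y∉ (there y∈xs)) y∉xs⇒y∉) (y ∉? x ∷ xs) (y ∉? xs)
    where
    y∉xs⇒y∉ : y ∉ xs → y ∉ x ∷ xs
    y∉xs⇒y∉ y∉xs (here y≡x)   = y≢x y≡x
    y∉xs⇒y∉ y∉xs (there y∈xs) = y∉xs y∈xs

-- Weights of words

module Weights (θ : ℚ) where

  -- As in recAux, pre lists the letters written so far, most recent first.
  stepWeight : List ℕ → ℕ → ℚ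
  stepWeight pre y with y ∈? pre | all? (_<? y) pre
  ... | yes _ | _     = 0ℚ
  ... | no _  | yes _ = θ
  ... | no _  | no _  = 1ℚ

  weight : List ℕ → List ℕ → ℚ
  weight pre []       = 1ℚ
  weight pre (y ∷ ys) = stepWeight pre y * weight (y ∷ pre) ys

  stepWeight-∈ : ∀ {pre y} → y ∈ pre → stepWeight pre y ≡ 0ℚ
  stepWeight-∈ {pre} {y} y∈pre with y ∈? pre
  ... | yes _    = refl
  ... | no y∉pre = contradiction y∈pre y∉pre

  stepWeight-record : ∀ {pre y} → y ∉ pre → All (_< y) pre → stepWeight pre y ≡ θ
  stepWeight-record {pre} {y} y∉pre rec with y ∈? pre | all? (_<? y) pre
  ... | yes y∈pre | _       = contradiction y∈pre y∉pre
  ... | no _      | yes _   = refl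
  ... | no _      | no ¬rec = contradiction rec ¬rec

  stepWeight-nonrecord : ∀ {pre y} → y ∉ pre → ¬ All (_< y) pre → stepWeight pre y ≡ 1ℚ
  stepWeight-nonrecord {pre} {y} y∉pre ¬rec with y ∈? pre | all? (_<? y) pre
  ... | yes y∈pre | _       = contradiction y∈pre y∉pre
  ... | no _      | yes rec = contradiction rec ¬rec
  ... | no _      | no _    = refl

  recAux-record : ∀ {pre y} ys → All (_< y) pre → recAux pre (y ∷ ys) ≡ suc (recAux (y ∷ pre) ys)
  recAux-record {pre} {y} ys rec with all? (_<? y) pre
  ... | yes _   = refl
  ... | no ¬rec = contradiction rec ¬rec

  recAux-nonrecord : ∀ {pre y} ys → ¬ All (_< y) pre → recAux pre (y ∷ ys) ≡ recAux (y ∷ pre) ys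
  recAux-nonrecord {pre} {y} ys ¬rec with all? (_<? y) pre
  ... | yes rec = contradiction rec ¬rec
  ... | no _    = refl

  Fresh : List ℕ → List ℕ → Set
  Fresh pre ws = All (_∉ pre) ws × Unique ws

  fresh? : ∀ pre ws → Dec (Fresh pre ws)
  fresh? pre ws = all? (_∉? pre) ws ×-dec unique? ws

  Fresh-[] : ∀ {ws} → Fresh [] ws ⇔ Unique ws
  Fresh-[] = mk⇔ (λ (_ , u) → u) (λ u → All.universal (λ _ ()) _ , u)

  Fresh-∷ : ∀ {pre y ys} → y ∉ pre → Fresh pre (y ∷ ys) ⇔ Fresh (y ∷ pre) ys
  Fresh-∷ {pre} {y} {ys} y∉pre = mk⇔ to from
    where
    ∉∷ : ∀ {z} → y ≢ z × z ∉ pre → z ∉ y ∷ pre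
    ∉∷ (y≢z , z∉pre) (here z≡y)    = y≢z (sym z≡y)
    ∉∷ (y≢z , z∉pre) (there z∈pre) = z∉pre z∈pre
    to : Fresh pre (y ∷ ys) → Fresh (y ∷ pre) ys
    to (_ ∷ ys∉pre , y≢ys ∷ u) = All.zipWith ∉∷ (y≢ys , ys∉pre) , u
    from : Fresh (y ∷ pre) ys → Fresh pre (y ∷ ys)
    from (ys∉ , u) =
      y∉pre ∷ All.map (λ z∉ → z∉ ∘ there) ys∉ , All.map (λ z∉ y≡z → z∉ (here (sym y≡z))) ys∉ ∷ u

  weight≡θ^recAux : ∀ pre ws → weight pre ws ≡ (if does (fresh? pre ws) then θ ^ recAux pre ws else 0ℚ)
  weight≡θ^recAux pre []       = refl
  weight≡θ^recAux pre (y ∷ ys) = cases (y ∈? pre) (all? (_<? y) pre)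
    where
    fresh≡ : y ∉ pre → does (fresh? pre (y ∷ ys)) ≡ does (fresh? (y ∷ pre) ys)
    fresh≡ y∉pre = does-⇔ (Fresh-∷ y∉pre) (fresh? pre (y ∷ ys)) (fresh? (y ∷ pre) ys)
    cases : Dec (y ∈ pre) → Dec (All (_< y) pre) →
            weight pre (y ∷ ys) ≡ (if does (fresh? pre (y ∷ ys)) then θ ^ recAux pre (y ∷ ys) else 0ℚ)
    cases (yes y∈pre) _
      rewrite stepWeight-∈ y∈pre | dec-false (fresh? pre (y ∷ ys)) (λ { (y∉pre ∷ _ , _) → y∉pre y∈pre })
      = ℚ.*-zeroˡ (weight (y ∷ pre) ys)
    cases (no y∉pre) (yes rec)
      rewrite stepWeight-record y∉pre rec | recAux-record ys rec | fresh≡ y∉pre | weight≡θ^recAux (y ∷ pre) ys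
      = *-ifˡ θ (does (fresh? (y ∷ pre) ys))
    cases (no y∉pre) (no ¬rec)
      rewrite stepWeight-nonrecord y∉pre ¬rec | recAux-nonrecord ys ¬rec | fresh≡ y∉pre
            | weight≡θ^recAux (y ∷ pre) ys
      = ℚ.*-identityˡ _

module Words (n : ℕ) (θ : ℚ) where
  open Weights θ

  word : ∀ {k} → Vec (Fin n) k → List ℕ
  word w = map toℕ (Vec.toList w)

  Z : List ℕ → ℕ → ℚ
  Z pre k = sumℚ (map (λ w → weight pre (word w)) (allWords n k))

  sum-weight-suc : ∀ pre k (u : ℕ → ℚ) →
    sumℚ (map (λ w → weight pre (word w) * u (toℕ (Vec.head w))) (allWords n (suc k))) ≡
    Σ< n (λ y → stepWeight pre y * Z (y ∷ pre) k * u y)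
  sum-weight-suc pre k u = begin
    sumℚ (map (λ w → weight pre (word w) * u (toℕ (Vec.head w))) (allWords n (suc k)))
      ≡⟨ sumℚ-allWords-suc n k _ ⟩
    sumℚ (map (λ x → sumℚ (map (λ w → t (toℕ x) * weight (toℕ x ∷ pre) (word w) * u (toℕ x))
                                (allWords n k)))
              (allFin n))
      ≡⟨ cong sumℚ (List.map-cong (λ x → first-letter (toℕ x)) (allFin n)) ⟩
    sumℚ (map (λ x → t (toℕ x) * Z (toℕ x ∷ pre) k * u (toℕ x)) (allFin n))
      ≡⟨ sumℚ-allFin n (λ y → t y * Z (y ∷ pre) k * u y) ⟩
    Σ< n (λ y → t y * Z (y ∷ pre) k * u y) ∎
    where
    open ≡-Reasoning
    t = stepWeight pre
    first-letter : ∀ y → sumℚ (map (λ w → t y * weight (y ∷ pre) (word w) * u y) (allWords n k)) ≡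
                         t y * Z (y ∷ pre) k * u y
    first-letter y = begin
      sumℚ (map (λ w → t y * weight (y ∷ pre) (word w) * u y) (allWords n k))
        ≡⟨ cong sumℚ (List.map-cong (λ w → *.xy∙z≈xz∙y (t y) _ (u y)) (allWords n k)) ⟩
      sumℚ (map (λ w → t y * u y * weight (y ∷ pre) (word w)) (allWords n k))
        ≡⟨ sumℚ-*ˡ (t y * u y) (λ w → weight (y ∷ pre) (word w)) (allWords n k) ⟩
      t y * u y * Z (y ∷ pre) k
        ≡⟨ *.xy∙z≈xz∙y (t y) (u y) _ ⟩
      t y * Z (y ∷ pre) k * u y ∎

  Z-suc : ∀ pre k → Z pre (suc k) ≡ Σ< n (λ y → stepWeight pre y * Z (y ∷ pre) k)
  Z-suc pre k = begin
    Z pre (suc k)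
      ≡⟨ cong sumℚ (List.map-cong (λ w → sym (ℚ.*-identityʳ (weight pre (word w)))) (allWords n (suc k))) ⟩
    sumℚ (map (λ w → weight pre (word w) * 1ℚ) (allWords n (suc k)))
      ≡⟨ sum-weight-suc pre k (λ _ → 1ℚ) ⟩
    Σ< n (λ y → stepWeight pre y * Z (y ∷ pre) k * 1ℚ)
      ≡⟨ Σ<-cong n (λ {y} _ → ℚ.*-identityʳ (stepWeight pre y * Z (y ∷ pre) k)) ⟩
    Σ< n (λ y → stepWeight pre y * Z (y ∷ pre) k) ∎
    where open ≡-Reasoning

  θ^rec≡weight : ∀ ws → (if does (unique? ws) then θ ^ recAux [] ws else 0ℚ) ≡ weight [] ws
  θ^rec≡weight ws = sym (trans (weight≡θ^recAux [] ws)
    (cong (λ b → if b then θ ^ recAux [] ws else 0ℚ) (does-⇔ Fresh-[] (fresh? [] ws) (unique? ws))))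

  sum-perms : ∀ (f : Vec (Fin n) n → ℚ) →
    sumℚ (map (λ σ → θ ^ rec σ * f σ) (perms n)) ≡ sumℚ (map (λ w → weight [] (word w) * f w) (allWords n n))
  sum-perms f = trans (sumℚ-filter (λ w → unique? (word w)) _ (allWords n n))
    (cong sumℚ (List.map-cong (λ w → trans (sym (*-ifʳ (f w) (does (unique? (word w)))))
                                           (cong (_* f w) (θ^rec≡weight (word w))))
                              (allWords n n)))

-- The closed form

module ClosedForm (θ : ℚ) where

  C : ℕ → ℕ → ℚ
  C zero    r = θ ↑ r
  C (suc c) r = ℕtoℚ (suc (c ℕ.+ r)) * C c r

  C-transfer : ∀ c r → (θ + ℕtoℚ r) * C (suc c) r ≡ ℕtoℚ (suc r) * C c (suc r)
  C-transfer zero    r = *.x∙yz≈y∙zx (θ + ℕtoℚ r) (ℕtoℚ (suc r)) (θ ↑ r)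
  C-transfer (suc c) r = begin
    (θ + ℕtoℚ r) * (k * C (suc c) r)   ≡⟨ *.x∙yz≈y∙xz (θ + ℕtoℚ r) k (C (suc c) r) ⟩
    k * ((θ + ℕtoℚ r) * C (suc c) r)   ≡⟨ cong (k *_) (C-transfer c r) ⟩
    k * (ℕtoℚ (suc r) * C c (suc r))   ≡⟨ *.x∙yz≈y∙xz k (ℕtoℚ (suc r)) (C c (suc r)) ⟩
    ℕtoℚ (suc r) * (k * C c (suc r))   ≡⟨ cong (λ i → ℕtoℚ (suc r) * (ℕtoℚ i * C c (suc r))) (ℕ.+-suc (suc c) r) ⟨
    ℕtoℚ (suc r) * C (suc c) (suc r)   ∎
    where
    open ≡-Reasoning
    k = ℕtoℚ (suc (suc c ℕ.+ r))

  θ*diag : ∀ s c → θ * diag C c (suc s) ≡ (θ + ℕtoℚ s) * C c s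
  θ*diag zero    c = trans (cong (θ *_) (ℚ.+-identityʳ (C c 0))) (cong (_* C c 0) (sym (ℚ.+-identityʳ θ)))
  θ*diag (suc s) c = begin
    θ * (C c (suc s) + diag C (suc c) (suc s))    ≡⟨ ℚ.*-distribˡ-+ θ (C c (suc s)) (diag C (suc c) (suc s)) ⟩
    θ * C c (suc s) + θ * diag C (suc c) (suc s)  ≡⟨ cong (θ * C c (suc s) +_) (θ*diag s (suc c)) ⟩
    θ * C c (suc s) + (θ + ℕtoℚ s) * C (suc c) s  ≡⟨ cong (θ * C c (suc s) +_) (C-transfer c s) ⟩
    θ * C c (suc s) + ℕtoℚ (suc s) * C c (suc s)  ≡⟨ ℚ.*-distribʳ-+ (C c (suc s)) θ (ℕtoℚ (suc s)) ⟨
    (θ + ℕtoℚ (suc s)) * C c (suc s)              ∎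
    where open ≡-Reasoning

  C-recurrence : ∀ c r → c ℕ.+ r ≢ 0 → ℕtoℚ c * C (ℕ.pred c) r + θ * diag C c r ≡ C c r
  C-recurrence zero    zero    c+r≢0 = ⊥-elim (c+r≢0 refl)
  C-recurrence (suc c) zero    _     = begin
    ℕtoℚ (suc c) * C c 0 + θ * 0ℚ  ≡⟨ cong (ℕtoℚ (suc c) * C c 0 +_) (ℚ.*-zeroʳ θ) ⟩
    ℕtoℚ (suc c) * C c 0 + 0ℚ      ≡⟨ ℚ.+-identityʳ _ ⟩
    ℕtoℚ (suc c) * C c 0           ≡⟨ cong (λ i → ℕtoℚ (suc i) * C c 0) (ℕ.+-identityʳ c) ⟨
    C (suc c) 0                    ∎
    where open ≡-Reasoning
  C-recurrence zero    (suc s) _     = begin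
    0ℚ * θ ↑ suc s + θ * diag C 0 (suc s)  ≡⟨ cong (_+ θ * diag C 0 (suc s)) (ℚ.*-zeroˡ (θ ↑ suc s)) ⟩
    0ℚ + θ * diag C 0 (suc s)               ≡⟨ ℚ.+-identityˡ _ ⟩
    θ * diag C 0 (suc s)                    ≡⟨ θ*diag s 0 ⟩
    (θ + ℕtoℚ s) * θ ↑ s                    ≡⟨ ℚ.*-comm (θ + ℕtoℚ s) (θ ↑ s) ⟩
    θ ↑ suc s                               ∎
    where open ≡-Reasoning
  C-recurrence (suc c) (suc s) _     = begin
    ℕtoℚ (suc c) * C c (suc s) + θ * diag C (suc c) (suc s)
      ≡⟨ cong (ℕtoℚ (suc c) * C c (suc s) +_) (θ*diag s (suc c)) ⟩
    ℕtoℚ (suc c) * C c (suc s) + (θ + ℕtoℚ s) * C (suc c) s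
      ≡⟨ cong (ℕtoℚ (suc c) * C c (suc s) +_) (C-transfer c s) ⟩
    ℕtoℚ (suc c) * C c (suc s) + ℕtoℚ (suc s) * C c (suc s)
      ≡⟨ ℚ.*-distribʳ-+ (C c (suc s)) (ℕtoℚ (suc c)) (ℕtoℚ (suc s)) ⟨
    (ℕtoℚ (suc c) + ℕtoℚ (suc s)) * C c (suc s)
      ≡⟨ cong (_* C c (suc s)) (ℕtoℚ-+ (suc c) (suc s)) ⟨
    C (suc c) (suc s) ∎
    where open ≡-Reasoning

  W : ℕ → ℚ
  W = diag C 0

  V : ℕ → ℚ
  V = diag (λ i s → ℕtoℚ (suc i) * C i s) 0

  θ*W : ∀ m → θ * W (suc m) ≡ θ ↑ suc m
  θ*W m = trans (θ*diag m 0) (ℚ.*-comm (θ + ℕtoℚ m) (θ ↑ m))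

  W-suc : ∀ m → W (suc m) ≡ C 0 m + ℕtoℚ m * W m
  W-suc m = cong (C 0 m +_) (diag-shift m 0 (λ _ _ → refl))

  V-suc : ∀ m → V (suc m) ≡ C 0 m + ℕtoℚ m * (V m + W m)
  V-suc m = cong₂ _+_ (ℚ.*-identityˡ (C 0 m)) (begin
    diag v 1 m
      ≡⟨ diag-shift m 0 (λ i s → *.x∙yz≈y∙xz (ℕtoℚ (suc (suc i))) (ℕtoℚ (suc (i ℕ.+ s))) (C i s)) ⟩
    ℕtoℚ m * diag (λ i s → ℕtoℚ (suc (suc i)) * C i s) 0 m
      ≡⟨ cong (ℕtoℚ m *_) (diag-cong m 0 split) ⟩
    ℕtoℚ m * diag (λ i s → v i s + C i s) 0 m
      ≡⟨ cong (ℕtoℚ m *_) (diag-+ m 0 v C) ⟩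
    ℕtoℚ m * (V m + W m) ∎)
    where
    open ≡-Reasoning
    v = λ i s → ℕtoℚ (suc i) * C i s
    split : ∀ i s → ℕtoℚ (suc (suc i)) * C i s ≡ v i s + C i s
    split i s = begin
      ℕtoℚ (suc (suc i)) * C i s   ≡⟨ cong (_* C i s) (ℕtoℚ-+ 1 (suc i)) ⟩
      (1ℚ + ℕtoℚ (suc i)) * C i s  ≡⟨ ℚ.*-distribʳ-+ (C i s) 1ℚ (ℕtoℚ (suc i)) ⟩
      1ℚ * C i s + v i s           ≡⟨ cong (_+ v i s) (ℚ.*-identityˡ (C i s)) ⟩
      C i s + v i s                ≡⟨ ℚ.+-comm (C i s) _ ⟩
      v i s + C i s                ∎

  V-mean : ∀ m → (θ + 1ℚ) * V (suc m) ≡ (θ + ℕtoℚ (suc m)) * W (suc m)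
  V-mean zero    = refl
  V-mean (suc m) = begin
    (θ + 1ℚ) * V (suc (suc m))
      ≡⟨ cong ((θ + 1ℚ) *_) (V-suc (suc m)) ⟩
    (θ + 1ℚ) * (θ ↑ suc m + x * (V (suc m) + w))
      ≡⟨ cong (λ c → (θ + 1ℚ) * (c + x * (V (suc m) + w))) (θ*W m) ⟨
    (θ + 1ℚ) * (θ * w + x * (V (suc m) + w))
      ≡⟨ step x (V (suc m)) w (V-mean m) ⟩
    (θ + (1ℚ + x)) * (θ * w + x * w)
      ≡⟨ cong₂ (λ k c → (θ + k) * (c + x * w)) (sym (ℕtoℚ-+ 1 (suc m))) (θ*W m) ⟩
    (θ + ℕtoℚ (suc (suc m))) * (θ ↑ suc m + x * w)
      ≡⟨ cong ((θ + ℕtoℚ (suc (suc m))) *_) (W-suc (suc m)) ⟨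
    (θ + ℕtoℚ (suc (suc m))) * W (suc (suc m)) ∎
    where
    open ≡-Reasoning
    open +-*-Solver using (solve; _:=_; con; _:+_; _:*_)
    x = ℕtoℚ (suc m)
    w = W (suc m)
    step : ∀ x v w → (θ + 1ℚ) * v ≡ (θ + x) * w →
           (θ + 1ℚ) * (θ * w + x * (v + w)) ≡ (θ + (1ℚ + x)) * (θ * w + x * w)
    step x v w eq = begin
      (θ + 1ℚ) * (θ * w + x * (v + w))
        ≡⟨ solve 4 (λ θ x v w → (θ :+ con 1ℚ) :* (θ :* w :+ x :* (v :+ w)) :=
                                 x :* ((θ :+ con 1ℚ) :* v) :+ (θ :+ con 1ℚ) :* (θ :+ x) :* w) refl θ x v w ⟩
      x * ((θ + 1ℚ) * v) + (θ + 1ℚ) * (θ + x) * w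
        ≡⟨ cong (λ e → x * e + (θ + 1ℚ) * (θ + x) * w) eq ⟩
      x * ((θ + x) * w) + (θ + 1ℚ) * (θ + x) * w
        ≡⟨ solve 3 (λ θ x w → x :* ((θ :+ x) :* w) :+ (θ :+ con 1ℚ) :* (θ :+ x) :* w :=
                               (θ :+ (con 1ℚ :+ x)) :* (θ :* w :+ x :* w)) refl θ x w ⟩
      (θ + (1ℚ + x)) * (θ * w + x * w) ∎

  θV-cross : ∀ m → θ * V (suc m) * (θ + 1ℚ) ≡ (θ + ℕtoℚ (suc m)) * θ ↑ suc m
  θV-cross m = begin
    θ * V (suc m) * (θ + 1ℚ)               ≡⟨ *.xy∙z≈x∙zy θ (V (suc m)) (θ + 1ℚ) ⟩
    θ * ((θ + 1ℚ) * V (suc m))             ≡⟨ cong (θ *_) (V-mean m) ⟩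
    θ * ((θ + ℕtoℚ (suc m)) * W (suc m))   ≡⟨ *.x∙yz≈y∙xz θ (θ + ℕtoℚ (suc m)) (W (suc m)) ⟩
    (θ + ℕtoℚ (suc m)) * (θ * W (suc m))   ≡⟨ cong ((θ + ℕtoℚ (suc m)) *_) (θ*W m) ⟩
    (θ + ℕtoℚ (suc m)) * θ ↑ suc m         ∎
    where open ≡-Reasoning

-- Completions of a prefix

module Completions (n : ℕ) (θ : ℚ) where
  open Weights θ
  open Words n θ
  open ClosedForm θ

  -- bound is one more than the largest letter of pre (0 if pre is empty); c letters below
  -- bound are unused and r letters lie above it.
  record Shape (pre : List ℕ) (c r : ℕ) : Set where
    field
      bound     : ℕ
      unique    : Unique pre
      bounded   : All (_< bound) pre
      no-record : ∀ {y} → y < bound → ¬ All (_< y) pre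
      unused    : length pre ℕ.+ c ≡ bound
      above     : bound ℕ.+ r ≡ n

  shape-[] : Shape [] 0 n
  shape-[] = record
    { bound = 0 ; unique = [] ; bounded = [] ; no-record = λ () ; unused = refl ; above = refl }

  module _ {pre c r} (S : Shape pre c r) where
    open Shape S

    shape-unused : ∀ {y c′} → c ≡ suc c′ → y < bound → y ∉ pre → Shape (y ∷ pre) c′ r
    shape-unused {y} {c′} refl y<bound y∉pre = record
      { bound     = bound
      ; unique    = ¬Any⇒All¬ pre y∉pre ∷ unique
      ; bounded   = y<bound ∷ bounded
      ; no-record = λ z<bound → λ { (_ ∷ pre<z) → no-record z<bound pre<z }
      ; unused    = trans (sym (ℕ.+-suc (length pre) c′)) unused
      ; above     = above
      }

    shape-record : ∀ {j s} → j ℕ.+ suc s ≡ r → Shape (bound ℕ.+ j ∷ pre) (c ℕ.+ j) s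
    shape-record {j} {s} j+s+1≡r = record
      { bound     = suc x
      ; unique    = All.map (λ z<bound x≡z → ℕ.<-irrefl (sym x≡z) (ℕ.<-≤-trans z<bound bound≤x)) bounded
                    ∷ unique
      ; bounded   = ℕ.n<1+n x ∷ All.map (λ z<bound → ℕ.<-trans (ℕ.<-≤-trans z<bound bound≤x) (ℕ.n<1+n x)) bounded
      ; no-record = λ { (s≤s y≤x) (x<y ∷ _) → ℕ.<-irrefl refl (ℕ.<-≤-trans x<y y≤x) }
      ; unused    = cong suc (trans (sym (ℕ.+-assoc (length pre) c j)) (cong (ℕ._+ j) unused))
      ; above     = begin
          suc x ℕ.+ s            ≡⟨ ℕ.+-suc x s ⟨
          x ℕ.+ suc s            ≡⟨ ℕ.+-assoc bound j (suc s) ⟩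
          bound ℕ.+ (j ℕ.+ suc s) ≡⟨ cong (bound ℕ.+_) j+s+1≡r ⟩
          bound ℕ.+ r            ≡⟨ above ⟩
          n                      ∎
      }
      where
      open ≡-Reasoning
      x = bound ℕ.+ j
      bound≤x = ℕ.m≤m+n bound j

    count-unused : count bound (λ y → does (y ∉? pre)) ≡ c
    count-unused = ℕ.+-cancelʳ-≡ (length pre) _ _
      (trans (count-∉ bound pre unique bounded) (trans (sym unused) (ℕ.+-comm (length pre) c)))

    unused-below⇒c≢0 : ∀ {y} → y < bound → y ∉ pre → c ≢ 0
    unused-below⇒c≢0 {y} y<bound y∉pre refl = ℕ.m+1+n≢n _ (begin
      count bound (λ z → does (z ∉? y ∷ pre)) ℕ.+ suc (length pre)
        ≡⟨ count-∉ bound (y ∷ pre) (¬Any⇒All¬ pre y∉pre ∷ unique) (y<bound ∷ bounded) ⟩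
      bound            ≡⟨ unused ⟨
      length pre ℕ.+ 0 ≡⟨ ℕ.+-identityʳ (length pre) ⟩
      length pre       ∎)
      where open ≡-Reasoning

  ClosedAt : ℕ → Set
  ClosedAt k = ∀ {pre c r} → Shape pre c r → c ℕ.+ r ≡ k → Z pre k ≡ C c r

  module _ {k} (closed : ClosedAt k) {pre c r} (S : Shape pre c r) (c+r≡1+k : c ℕ.+ r ≡ suc k) where
    open Shape S

    below-bound : Σ< bound (λ y → stepWeight pre y * Z (y ∷ pre) k) ≡ ℕtoℚ c * C (ℕ.pred c) r
    below-bound = begin
      Σ< bound (λ y → stepWeight pre y * Z (y ∷ pre) k)
        ≡⟨ Σ<-cong bound (λ {y} y<bound → summand y<bound (y ∈? pre)) ⟩
      Σ< bound (λ y → if does (y ∉? pre) then C (ℕ.pred c) r else 0ℚ)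
        ≡⟨ Σ<-indicator bound (λ y → does (y ∉? pre)) (C (ℕ.pred c) r) ⟩
      ℕtoℚ (count bound (λ y → does (y ∉? pre))) * C (ℕ.pred c) r
        ≡⟨ cong (λ i → ℕtoℚ i * C (ℕ.pred c) r) (count-unused S) ⟩
      ℕtoℚ c * C (ℕ.pred c) r ∎
      where
      open ≡-Reasoning
      summand : ∀ {y} → y < bound → Dec (y ∈ pre) →
                stepWeight pre y * Z (y ∷ pre) k ≡ (if does (y ∉? pre) then C (ℕ.pred c) r else 0ℚ)
      summand {y} _ (yes y∈pre)
        rewrite stepWeight-∈ y∈pre | dec-false (y ∉? pre) (λ y∉pre → y∉pre y∈pre)
        = ℚ.*-zeroˡ (Z (y ∷ pre) k)
      summand {y} y<bound (no y∉pre)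
        rewrite stepWeight-nonrecord y∉pre (no-record y<bound) | dec-true (y ∉? pre) y∉pre
        = trans (ℚ.*-identityˡ (Z (y ∷ pre) k))
                (closed (shape-unused S c≡1+c′ y<bound y∉pre)
                        (ℕ.suc-injective (trans (cong (ℕ._+ r) (sym c≡1+c′)) c+r≡1+k)))
        where
        c≡1+c′ : c ≡ suc (ℕ.pred c)
        c≡1+c′ = sym (ℕ.suc-pred c {{ℕ.≢-nonZero (unused-below⇒c≢0 S y<bound y∉pre)}})

    above-bound : Σ< r (λ j → stepWeight pre (bound ℕ.+ j) * Z (bound ℕ.+ j ∷ pre) k) ≡ θ * diag C c r
    above-bound = begin
      Σ< r (λ j → stepWeight pre (bound ℕ.+ j) * Z (bound ℕ.+ j ∷ pre) k)
        ≡⟨ Σ<-cong r (λ {j} _ → cong (_* Z (bound ℕ.+ j ∷ pre) k) (stepWeight-record (x∉pre j) (pre<x j))) ⟩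
      Σ< r (λ j → θ * Z (bound ℕ.+ j ∷ pre) k)
        ≡⟨ Σ<-*ˡ r θ (λ j → Z (bound ℕ.+ j ∷ pre) k) ⟩
      θ * Σ< r (λ j → Z (bound ℕ.+ j ∷ pre) k)
        ≡⟨ cong (θ *_) (Σ<-diag r c (λ j+s+1≡r → closed (shape-record S j+s+1≡r) (remaining j+s+1≡r))) ⟩
      θ * diag C c r ∎
      where
      open ≡-Reasoning
      x∉pre : ∀ j → bound ℕ.+ j ∉ pre
      x∉pre j x∈pre = ℕ.m+n≮m bound j (All.lookup bounded x∈pre)
      pre<x : ∀ j → All (_< bound ℕ.+ j) pre
      pre<x j = All.map (λ z<bound → ℕ.<-≤-trans z<bound (ℕ.m≤m+n bound j)) bounded
      remaining : ∀ {j s} → j ℕ.+ suc s ≡ r → c ℕ.+ j ℕ.+ s ≡ k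
      remaining {j} {s} j+s+1≡r = ℕ.suc-injective (begin
        suc (c ℕ.+ j ℕ.+ s)  ≡⟨ ℕ.+-suc (c ℕ.+ j) s ⟨
        c ℕ.+ j ℕ.+ suc s    ≡⟨ ℕ.+-assoc c j (suc s) ⟩
        c ℕ.+ (j ℕ.+ suc s)  ≡⟨ cong (c ℕ.+_) j+s+1≡r ⟩
        c ℕ.+ r              ≡⟨ c+r≡1+k ⟩
        suc k                ∎)

  Z-closed : ∀ k → ClosedAt k
  Z-closed zero    {c = zero}  {zero}  S refl = ℚ.+-identityʳ 1ℚ
  Z-closed zero    {c = zero}  {suc r} S ()
  Z-closed zero    {c = suc c}         S ()
  Z-closed (suc k) {pre} {c} {r} S c+r≡1+k = begin
    Z pre (suc k)
      ≡⟨ Z-suc pre k ⟩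
    Σ< n t
      ≡⟨ cong (λ N → Σ< N t) above ⟨
    Σ< (bound ℕ.+ r) t
      ≡⟨ Σ<-+ bound r t ⟩
    Σ< bound t + Σ< r (λ j → t (bound ℕ.+ j))
      ≡⟨ cong₂ _+_ (below-bound (Z-closed k) S c+r≡1+k) (above-bound (Z-closed k) S c+r≡1+k) ⟩
    ℕtoℚ c * C (ℕ.pred c) r + θ * diag C c r
      ≡⟨ C-recurrence c r (λ c+r≡0 → ℕ.1+n≢0 (trans (sym c+r≡1+k) c+r≡0)) ⟩
    C c r ∎
    where
    open ≡-Reasoning
    open Shape S
    t = λ y → stepWeight pre y * Z (y ∷ pre) k

  sum-weight-by-first-letter : ∀ m → suc m ≡ n → (u : ℕ → ℚ) →
    sumℚ (map (λ w → weight [] (word w) * u (toℕ (Vec.head w))) (allWords n (suc m))) ≡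
    θ * diag (λ i s → u i * C i s) 0 n
  sum-weight-by-first-letter m 1+m≡n u = begin
    sumℚ (map (λ w → weight [] (word w) * u (toℕ (Vec.head w))) (allWords n (suc m)))
      ≡⟨ sum-weight-suc [] m u ⟩
    Σ< n (λ y → θ * Z (y ∷ []) m * u y)
      ≡⟨ Σ<-cong n (λ {y} _ → *.xy∙z≈x∙zy θ (Z (y ∷ []) m) (u y)) ⟩
    Σ< n (λ y → θ * (u y * Z (y ∷ []) m))
      ≡⟨ Σ<-*ˡ n θ (λ y → u y * Z (y ∷ []) m) ⟩
    θ * Σ< n (λ y → u y * Z (y ∷ []) m)
      ≡⟨ cong (θ *_) (Σ<-diag n 0 (λ j+s+1≡n → cong (u _ *_) (first-letter j+s+1≡n))) ⟩
    θ * diag (λ i s → u i * C i s) 0 n ∎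
    where
    open ≡-Reasoning
    first-letter : ∀ {j s} → j ℕ.+ suc s ≡ n → Z (j ∷ []) m ≡ C j s
    first-letter {j} {s} j+s+1≡n = Z-closed m (shape-record shape-[] j+s+1≡n)
      (ℕ.suc-injective (trans (sym (ℕ.+-suc j s)) (trans j+s+1≡n (sym 1+m≡n))))

total-weight : ∀ n θ → sumℚ (map (λ σ → θ ^ rec σ) (perms n)) ≡ θ ↑ n
total-weight n θ = begin
  sumℚ (map (λ σ → θ ^ rec σ) (perms n))
    ≡⟨ cong sumℚ (List.map-cong (λ σ → sym (ℚ.*-identityʳ (θ ^ rec σ))) (perms n)) ⟩
  sumℚ (map (λ σ → θ ^ rec σ * 1ℚ) (perms n))
    ≡⟨ sum-perms (λ _ → 1ℚ) ⟩
  sumℚ (map (λ w → weight [] (word w) * 1ℚ) (allWords n n))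
    ≡⟨ cong sumℚ (List.map-cong (λ w → ℚ.*-identityʳ (weight [] (word w))) (allWords n n)) ⟩
  Z [] n
    ≡⟨ Z-closed n shape-[] refl ⟩
  θ ↑ n ∎
  where
  open ≡-Reasoning
  open Weights θ
  open Words n θ
  open Completions n θ

first-entry-weight : ∀ m θ →
  sumℚ (map (λ σ → θ ^ rec σ * firstEntry σ) (perms (suc m))) ≡ θ * ClosedForm.V θ (suc m)
first-entry-weight m θ =
  trans (sum-perms firstEntry) (sum-weight-by-first-letter m refl (λ i → ℕtoℚ (suc i)))
  where
  open Words (suc m) θ
  open Completions (suc m) θ

corollary3 : (m : ℕ) (θ : ℚ) → θ > 0ℚ →
    𝔼 (suc m) θ firstEntry ≡ (θ + ℕtoℚ (suc m)) div (θ + 1ℚ)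
corollary3 m θ θ>0 = begin
  𝔼 (suc m) θ firstEntry
    ≡⟨ cong₂ _div_ (first-entry-weight m θ) (total-weight (suc m) θ) ⟩
  (θ * V (suc m)) div (θ ↑ suc m)
    ≡⟨ div-cross _ _ _ _ (pos⇒≢0 (θ ↑ suc m)) (pos⇒≢0 (θ + 1ℚ)) (θV-cross m) ⟩
  (θ + ℕtoℚ (suc m)) div (θ + 1ℚ) ∎
  where
  open ≡-Reasoning
  open ClosedForm θ
  instance
    _ = ℚ.positive θ>0
    _ = ↑-pos θ (suc m)
    _ = ℚ.pos+pos⇒pos θ 1ℚ
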